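{- Let $U=(E,\mathcal{D},\rho)$ be a U-matroid and let $a\in E$ with $\{a\}\notin\mathcal{D}$. Let $\mathcal{D}[a]=\mathcal{D}\cup\{S\cup\{a\}:S\in\mathcal{D}\}$, and define $\rho_a:\mathcal{D}[a]\to\mathbb{N}$ by \[\rho_a(S)=\begin{cases}\rho(S)&\text{if }S\in\mathcal{D},\\ \rho(S\setminus\{a\})&\text{if }S\notin\mathcal{D}\text{ and }\rho(S\setminus\{a\})=\rho(\sup_{\mathcal{D}}(S)),\\ \rho(S\setminus\{a\})+1&\text{if }S\notin\mathcal{D}\text{ and }\rho(S\setminus\{a\})<\rho(\sup_{\mathcal{D}}(S)).\end{cases}\] Then $(E,\mathcal{D}[a],\rho_a)$ is a U-matroid (and hence a lattice extension of $U$).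
   Context: $E$ is a finite set. A U-matroid is a triple $(E,\mathcal{D},\rho)$ where $\mathcal{D}\subseteq2^E$ contains $\emptyset,E$, is closed under union and intersection, and is accessible (every nonempty $A\in\mathcal{D}$ contains some $x$ with $A\setminus\{x\}\in\mathcal{D}$), and $\rho:\mathcal{D}\to\mathbb{N}$ satisfies $\rho(\emptyset)=0$, monotonicity, submodularity ($\rho(A)+\rho(B)\ge\rho(A\cup B)+\rho(A\cap B)$), and unit increase ($\rho(A\cup\{e\})-\rho(A)\le1$ whenever $A,A\cup\{e\}\in\mathcal{D}$). For $A\subseteq E$, $\sup_{\mathcal{D}}(A)=\bigcap\{B\in\mathcal{D}:B\supseteq A\}$, the smallest element of $\mathcal{D}$ containing $A$. Note that if $S\in\mathcal{D}[a]\setminus\mathcal{D}$ then $a\in S$ and $S\setminus\{a\}\in\mathcal{D}$. A lattice extension of $U$ is a U-matroid $(E,\mathcal{D}',\rho')$ with $\mathcal{D}\subseteq\mathcal{D}'$ and $\rho'|_{\mathcal{D}}=\rho$. The function $\rho_a$ is called the generous atom extension of $\rho$ to $\mathcal{D}[a]$. -}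

module Defs where

open import Data.Nat using (ℕ; zero; suc; _+_; _∸_; _≤_; _≟_)
open import Data.Bool using (Bool; true; false)
open import Data.Fin using (Fin)
open import Data.Fin.Subset using (Subset; _∈_; _∉_; _⊆_; _∪_; _∩_; _-_; ⁅_⁆; ⋂; ⊥; ⊤; Nonempty)
open import Data.Fin.Subset.Properties using (_⊆?_)
open import Data.List using (List; []; _∷_; map; _++_; filter)
open import Data.Vec using (_∷_; [])
open import Data.Product using (Σ; _×_; ∃; _,_)
open import Data.Sum using (_⊎_)
open import Relation.Unary using (Pred; Decidable)
open import Relation.Nullary using (¬_; yes; no)
open import Relation.Nullary.Decidable using (_×-dec_)
open import Relation.Binary.PropositionalEquality using (_≡_)
open import Level using (0ℓ)

-- The ground set E is Fin n; subsets of E are `Subset n`.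
-- A family 𝒟 of subsets is a predicate on subsets; ρ is given as a
-- function on all subsets, of which only its values on 𝒟 matter.

record IsUMatroid {n : ℕ} (𝒟 : Pred (Subset n) 0ℓ) (ρ : Subset n → ℕ) : Set where
  field
    ∅∈𝒟          : 𝒟 ⊥
    E∈𝒟          : 𝒟 ⊤
    ∪-closed     : ∀ A B → 𝒟 A → 𝒟 B → 𝒟 (A ∪ B)
    ∩-closed     : ∀ A B → 𝒟 A → 𝒟 B → 𝒟 (A ∩ B)
    accessible   : ∀ A → 𝒟 A → Nonempty A → Σ (Fin n) λ x → x ∈ A × 𝒟 (A - x)
    ρ-∅          : ρ ⊥ ≡ 0
    monotone     : ∀ A B → 𝒟 A → 𝒟 B → A ⊆ B → ρ A ≤ ρ B
    submodular   : ∀ A B → 𝒟 A → 𝒟 B → ρ (A ∪ B) + ρ (A ∩ B) ≤ ρ A + ρ B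
    unitIncrease : ∀ A e → 𝒟 A → 𝒟 (A ∪ ⁅ e ⁆) → ρ (A ∪ ⁅ e ⁆) ∸ ρ A ≤ 1

allSubsets : (n : ℕ) → List (Subset n)
allSubsets zero    = [] ∷ []
allSubsets (suc n) = map (false ∷_) (allSubsets n) ++ map (true ∷_) (allSubsets n)

sup : {n : ℕ} {𝒟 : Pred (Subset n) 0ℓ} → Decidable 𝒟 → Subset n → Subset n
sup {n} 𝒟? A = ⋂ (filter (λ B → 𝒟? B ×-dec (A ⊆? B)) (allSubsets n))

_[_] : {n : ℕ} → Pred (Subset n) 0ℓ → Fin n → Pred (Subset n) 0ℓ
(𝒟 [ a ]) T = 𝒟 T ⊎ Σ (Subset _) λ S → 𝒟 S × T ≡ S ∪ ⁅ a ⁆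

ρₐ : {n : ℕ} {𝒟 : Pred (Subset n) 0ℓ} → Decidable 𝒟 → (Subset n → ℕ) → Fin n → Subset n → ℕ
ρₐ 𝒟? ρ a S with 𝒟? S
... | yes _ = ρ S
... | no  _ with ρ (S - a) ≟ ρ (sup 𝒟? S)
...   | yes _ = ρ (S - a)
...   | no  _ = suc (ρ (S - a))

module Submission where

-- In a U-matroid ρ X ≤ ρ Y + ∣ X ─ Y ∣ for X, Y ∈ 𝒟: peel X along accessibility, paying 1 by
-- unit increase when the removed element lies outside Y, and nothing (by submodularity) when it
-- lies inside. On 𝒟[a] the generous extension is exactly ρₐ X = min over Y ∈ 𝒟 of
-- ρ Y + ∣ X ─ Y ∣: the minimum is attained at X itself for old sets, and at X - a or sup X
-- (the two cases of the definition) for new ones. Monotonicity, submodularity and unit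
-- increase of ρₐ are then inherited from those of ρ by counting ∣ X ─ Y ∣.

open import Defs
open import Level using (0ℓ)
open import Data.Nat using (ℕ; suc; _+_; _∸_; _≤_; _<_; _⊓_; _≟_; s≤s)
open import Data.Nat.Properties
open import Data.Nat.Induction using (<-wellFounded)
open import Induction.WellFounded using (Acc; acc)
open import Algebra.Properties.CommutativeSemigroup +-commutativeSemigroup using (interchange)
open import Algebra.Bundles using (CommutativeMonoid)
open import Data.Bool using (false; true)
open import Data.Fin using (Fin)
open import Data.Fin.Properties using () renaming (_≟_ to _≟ᶠ_)
open import Data.Fin.Subset using (Subset; _∈_; _∉_; _⊆_; _∪_; _∩_; _─_; _-_; ⁅_⁆; ⋂; ⊥; ⊤; ∣_∣; Nonempty)
open import Data.Fin.Subset.Properties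
open import Data.Vec using ([]; _∷_; here; there)
open import Data.List using (_∷_; map; filter)
import Data.List.Relation.Unary.Any as Any
open import Data.List.Relation.Unary.All as All using (All; []; _∷_)
open import Data.List.Relation.Unary.All.Properties using (all-filter)
open import Data.List.Membership.Propositional using () renaming (_∈_ to _∈ₗ_)
open import Data.List.Membership.Propositional.Properties using (∈-map⁺; ∈-++⁺ˡ; ∈-++⁺ʳ; ∈-filter⁺)
open import Data.Product using (Σ; _×_; _,_; proj₁; proj₂)
open import Data.Sum using (_⊎_; inj₁; inj₂; [_,_]′)
open import Function using (_∘_)
open import Relation.Unary using (Pred; Decidable)
open import Relation.Nullary using (¬_; Dec; yes; no; contradiction)
open import Relation.Nullary.Decidable using (_×-dec_)
open import Relation.Binary.PropositionalEquality using (_≡_; refl; sym; trans; cong; subst)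

∣p∪q∣+∣p∩q∣≡∣p∣+∣q∣ : ∀ {n} (p q : Subset n) → ∣ p ∪ q ∣ + ∣ p ∩ q ∣ ≡ ∣ p ∣ + ∣ q ∣
∣p∪q∣+∣p∩q∣≡∣p∣+∣q∣ []          []          = refl
∣p∪q∣+∣p∩q∣≡∣p∣+∣q∣ (true  ∷ p) (true  ∷ q) =
  cong suc (trans (+-suc ∣ p ∪ q ∣ ∣ p ∩ q ∣)
                  (trans (cong suc (∣p∪q∣+∣p∩q∣≡∣p∣+∣q∣ p q)) (sym (+-suc ∣ p ∣ ∣ q ∣))))
∣p∪q∣+∣p∩q∣≡∣p∣+∣q∣ (true  ∷ p) (false ∷ q) = cong suc (∣p∪q∣+∣p∩q∣≡∣p∣+∣q∣ p q)
∣p∪q∣+∣p∩q∣≡∣p∣+∣q∣ (false ∷ p) (true  ∷ q) =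
  trans (cong suc (∣p∪q∣+∣p∩q∣≡∣p∣+∣q∣ p q)) (sym (+-suc ∣ p ∣ ∣ q ∣))
∣p∪q∣+∣p∩q∣≡∣p∣+∣q∣ (false ∷ p) (false ∷ q) = ∣p∪q∣+∣p∩q∣≡∣p∣+∣q∣ p q

x∈p─q⇒x∉q : ∀ {n} {p q : Subset n} {x} → x ∈ p ─ q → x ∉ q
x∈p─q⇒x∉q {p = true ∷ _} {q = false ∷ _} here ()
x∈p─q⇒x∉q {p = _ ∷ _}    {q = _ ∷ _}     (there x∈p─q) (there x∈q) = x∈p─q⇒x∉q x∈p─q x∈q

∈-allSubsets : ∀ {n} (p : Subset n) → p ∈ₗ allSubsets n
∈-allSubsets []                  = Any.here refl
∈-allSubsets (false ∷ p)         = ∈-++⁺ˡ (∈-map⁺ (false ∷_) (∈-allSubsets p))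
∈-allSubsets {suc n} (true ∷ p) =
  ∈-++⁺ʳ (map (false ∷_) (allSubsets n)) (∈-map⁺ (true ∷_) (∈-allSubsets p))

module _ {n : ℕ} where

  ∣p∪q∣≤∣p∣+∣q∣ : ∀ (p q : Subset n) → ∣ p ∪ q ∣ ≤ ∣ p ∣ + ∣ q ∣
  ∣p∪q∣≤∣p∣+∣q∣ p q = ≤-trans (m≤m+n _ _) (≤-reflexive (∣p∪q∣+∣p∩q∣≡∣p∣+∣q∣ p q))

  p⊆q⇒∣p─q∣≡0 : ∀ {p q : Subset n} → p ⊆ q → ∣ p ─ q ∣ ≡ 0
  p⊆q⇒∣p─q∣≡0 {p} {q} p⊆q = n≤0⇒n≡0 (≤-trans (p⊆q⇒∣p∣≤∣q∣ p─q⊆⊥) (≤-reflexive (∣⊥∣≡0 n)))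
    where
    p─q⊆⊥ : p ─ q ⊆ ⊥
    p─q⊆⊥ x∈p─q = contradiction (p⊆q (p─q⊆p p q x∈p─q)) (x∈p─q⇒x∉q x∈p─q)

  ∣p-x─q∣<∣p─q∣ : ∀ {p q : Subset n} {x} → x ∈ p → x ∉ q → ∣ p - x ─ q ∣ < ∣ p ─ q ∣
  ∣p-x─q∣<∣p─q∣ {p} {q} {x} x∈p x∉q =
    subst (λ r → ∣ r ∣ < ∣ p ─ q ∣) (p─q─r≡p─r─q p q ⁅ x ⁆) (x∈p⇒∣p-x∣<∣p∣ (x∈p∧x∉q⇒x∈p─q x∈p x∉q))

  ∣p─r∣≤∣q─r∣ : ∀ {p q : Subset n} r → p ⊆ q → ∣ p ─ r ∣ ≤ ∣ q ─ r ∣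
  ∣p─r∣≤∣q─r∣ {p} r p⊆q = p⊆q⇒∣p∣≤∣q∣ λ x∈p─r →
    x∈p∧x∉q⇒x∈p─q (p⊆q (p─q⊆p p r x∈p─r)) (x∈p─q⇒x∉q x∈p─r)

  ∣r─r∩q∣≤∣p─q∣ : ∀ {p r : Subset n} q → r ⊆ p → ∣ r ─ r ∩ q ∣ ≤ ∣ p ─ q ∣
  ∣r─r∩q∣≤∣p─q∣ {r = r} q r⊆p = p⊆q⇒∣p∣≤∣q∣ λ x∈r─r∩q →
    let x∈r = p─q⊆p r (r ∩ q) x∈r─r∩q
    in x∈p∧x∉q⇒x∈p─q (r⊆p x∈r) (λ x∈q → x∈p─q⇒x∉q x∈r─r∩q (x∈p∩q⁺ (x∈r , x∈q)))

  ∣r∪q─q∣≤∣p─q∣ : ∀ {p r : Subset n} q → r ⊆ p → ∣ r ∪ q ─ q ∣ ≤ ∣ p ─ q ∣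
  ∣r∪q─q∣≤∣p─q∣ {r = r} q r⊆p = p⊆q⇒∣p∣≤∣q∣ λ x∈r∪q─q →
    let x∉q = x∈p─q⇒x∉q x∈r∪q─q
        x∈r = [ (λ x∈r → x∈r) , (λ x∈q → contradiction x∈q x∉q) ]′ (x∈p∪q⁻ r q (p─q⊆p (r ∪ q) q x∈r∪q─q))
    in x∈p∧x∉q⇒x∈p─q (r⊆p x∈r) x∉q

  ∣p∪q─r∣≤∣p─r∣+∣q∣ : ∀ (p q r : Subset n) → ∣ p ∪ q ─ r ∣ ≤ ∣ p ─ r ∣ + ∣ q ∣
  ∣p∪q─r∣≤∣p─r∣+∣q∣ p q r = ≤-trans (p⊆q⇒∣p∣≤∣q∣ p∪q─r⊆) (∣p∪q∣≤∣p∣+∣q∣ (p ─ r) q)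
    where
    p∪q─r⊆ : p ∪ q ─ r ⊆ (p ─ r) ∪ q
    p∪q─r⊆ x∈ = [ (λ x∈p → p⊆p∪q q (x∈p∧x∉q⇒x∈p─q x∈p (x∈p─q⇒x∉q x∈))) , q⊆p∪q (p ─ r) q ]′
                  (x∈p∪q⁻ p q (p─q⊆p (p ∪ q) r x∈))

  ∣p─p-x∣≤1 : ∀ (p : Subset n) x → ∣ p ─ (p - x) ∣ ≤ 1
  ∣p─p-x∣≤1 p x = ≤-trans (p⊆q⇒∣p∣≤∣q∣ p─p-x⊆⁅x⁆) (≤-reflexive (∣⁅x⁆∣≡1 x))
    where
    p─p-x⊆⁅x⁆ : p ─ (p - x) ⊆ ⁅ x ⁆
    p─p-x⊆⁅x⁆ {y} y∈ with y ≟ᶠ x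
    ... | yes refl = x∈⁅x⁆ x
    ... | no y≢x   = contradiction (x∈p∧x≢y⇒x∈p-y (p─q⊆p p (p - x) y∈) y≢x) (x∈p─q⇒x∉q y∈)

  ∣p∪q─r∪s∣+∣p∩q─r∩s∣≤∣p─r∣+∣q─s∣ : ∀ (p q r s : Subset n) →
    ∣ p ∪ q ─ r ∪ s ∣ + ∣ p ∩ q ─ r ∩ s ∣ ≤ ∣ p ─ r ∣ + ∣ q ─ s ∣
  ∣p∪q─r∪s∣+∣p∩q─r∩s∣≤∣p─r∣+∣q─s∣ p q r s = begin
    ∣ L ∣ + ∣ M ∣          ≡⟨ ∣p∪q∣+∣p∩q∣≡∣p∣+∣q∣ L M ⟨
    ∣ L ∪ M ∣ + ∣ L ∩ M ∣  ≤⟨ +-mono-≤ (p⊆q⇒∣p∣≤∣q∣ L∪M⊆P∪Q) (p⊆q⇒∣p∣≤∣q∣ L∩M⊆P∩Q) ⟩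
    ∣ P ∪ Q ∣ + ∣ P ∩ Q ∣  ≡⟨ ∣p∪q∣+∣p∩q∣≡∣p∣+∣q∣ P Q ⟩
    ∣ P ∣ + ∣ Q ∣          ∎
    where
    open ≤-Reasoning
    L = p ∪ q ─ r ∪ s
    M = p ∩ q ─ r ∩ s
    P = p ─ r
    Q = q ─ s

    L∪M⊆P∪Q : L ∪ M ⊆ P ∪ Q
    L∪M⊆P∪Q {x} x∈L∪M with x∈p∪q⁻ L M x∈L∪M
    ... | inj₁ x∈L = [ (λ x∈p → p⊆p∪q Q (x∈p∧x∉q⇒x∈p─q x∈p (x∉r∪s ∘ p⊆p∪q s)))
                     , (λ x∈q → q⊆p∪q P Q (x∈p∧x∉q⇒x∈p─q x∈q (x∉r∪s ∘ q⊆p∪q r s))) ]′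
                     (x∈p∪q⁻ p q (p─q⊆p (p ∪ q) (r ∪ s) x∈L))
      where x∉r∪s = x∈p─q⇒x∉q x∈L
    ... | inj₂ x∈M with x∈p∩q⁻ p q (p─q⊆p (p ∩ q) (r ∩ s) x∈M) | x ∈? r
    ...   | x∈p , x∈q | yes x∈r =
            q⊆p∪q P Q (x∈p∧x∉q⇒x∈p─q x∈q (λ x∈s → x∈p─q⇒x∉q x∈M (x∈p∩q⁺ (x∈r , x∈s))))
    ...   | x∈p , _   | no x∉r  = p⊆p∪q Q (x∈p∧x∉q⇒x∈p─q x∈p x∉r)

    L∩M⊆P∩Q : L ∩ M ⊆ P ∩ Q
    L∩M⊆P∩Q x∈L∩M with x∈p∩q⁻ L M x∈L∩M
    ... | x∈L , x∈M with x∈p∩q⁻ p q (p─q⊆p (p ∩ q) (r ∩ s) x∈M)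
    ...   | x∈p , x∈q = x∈p∩q⁺ ( x∈p∧x∉q⇒x∈p─q x∈p (x∈p─q⇒x∉q x∈L ∘ p⊆p∪q s)
                               , x∈p∧x∉q⇒x∈p─q x∈q (x∈p─q⇒x∉q x∈L ∘ q⊆p∪q r s))

  p⊆p-x∪q : ∀ {p q : Subset n} {x} → x ∈ q → p ⊆ (p - x) ∪ q
  p⊆p-x∪q {p} {q} {x} x∈q {y} y∈p with y ≟ᶠ x
  ... | yes refl = q⊆p∪q (p - x) q x∈q
  ... | no y≢x   = p⊆p∪q q (x∈p∧x≢y⇒x∈p-y y∈p y≢x)

  x∈p⇒p-x∪⁅x⁆≡p : ∀ {p : Subset n} {x} → x ∈ p → (p - x) ∪ ⁅ x ⁆ ≡ p
  x∈p⇒p-x∪⁅x⁆≡p {p} {x} x∈p = ⊆-antisym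
    (λ y∈ → [ p─q⊆p p ⁅ x ⁆ , (λ y∈⁅x⁆ → subst (_∈ p) (sym (x∈⁅y⁆⇒x≡y x y∈⁅x⁆)) x∈p) ]′
              (x∈p∪q⁻ (p - x) ⁅ x ⁆ y∈))
    (p⊆p-x∪q (x∈⁅x⁆ x))

  x∈p⇒p∪⁅x⁆≡p : ∀ {p : Subset n} {x} → x ∈ p → p ∪ ⁅ x ⁆ ≡ p
  x∈p⇒p∪⁅x⁆≡p {p} {x} x∈p = ⊆-antisym
    (λ y∈ → [ (λ y∈p → y∈p) , (λ y∈⁅x⁆ → subst (_∈ p) (sym (x∈⁅y⁆⇒x≡y x y∈⁅x⁆)) x∈p) ]′
              (x∈p∪q⁻ p ⁅ x ⁆ y∈))
    (p⊆p∪q ⁅ x ⁆)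

  x∉p⇒p∪⁅x⁆-x≡p : ∀ {p : Subset n} {x} → x ∉ p → p ∪ ⁅ x ⁆ - x ≡ p
  x∉p⇒p∪⁅x⁆-x≡p {p} {x} x∉p = ⊆-antisym
    (λ y∈ → [ (λ y∈p → y∈p) , (λ y∈⁅x⁆ → contradiction y∈⁅x⁆ (x∈p─q⇒x∉q y∈)) ]′
              (x∈p∪q⁻ p ⁅ x ⁆ (p─q⊆p (p ∪ ⁅ x ⁆) ⁅ x ⁆ y∈)))
    (λ y∈p → x∈p∧x≢y⇒x∈p-y (p⊆p∪q ⁅ x ⁆ y∈p) (λ { refl → x∉p y∈p }))

  x∈p⇒⁅x⁆∩p≡⁅x⁆ : ∀ {p : Subset n} {x} → x ∈ p → ⁅ x ⁆ ∩ p ≡ ⁅ x ⁆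
  x∈p⇒⁅x⁆∩p≡⁅x⁆ {p} {x} x∈p = ⊆-antisym (p∩q⊆p ⁅ x ⁆ p)
    (λ y∈⁅x⁆ → x∈p∩q⁺ (y∈⁅x⁆ , subst (_∈ p) (sym (x∈⁅y⁆⇒x≡y x y∈⁅x⁆)) x∈p))

  x∉p⇒⁅x⁆∩p≡⊥ : ∀ {p : Subset n} {x} → x ∉ p → ⁅ x ⁆ ∩ p ≡ ⊥
  x∉p⇒⁅x⁆∩p≡⊥ {p} {x} x∉p = Empty-unique λ { (y , y∈) →
    let y∈⁅x⁆ , y∈p = x∈p∩q⁻ ⁅ x ⁆ p y∈ in x∉p (subst (_∈ p) (x∈⁅y⁆⇒x≡y x y∈⁅x⁆) y∈p) }

  ⊆-⋂ : ∀ {A : Subset n} {Bs} → All (A ⊆_) Bs → A ⊆ ⋂ Bs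
  ⊆-⋂ []               = ⊆⊤
  ⊆-⋂ (A⊆B ∷ A⊆⋂Bs) x∈A = x∈p∩q⁺ (A⊆B x∈A , ⊆-⋂ A⊆⋂Bs x∈A)

  ⋂-⊆ : ∀ {B : Subset n} {Bs} → B ∈ₗ Bs → ⋂ Bs ⊆ B
  ⋂-⊆ {Bs = B ∷ Bs} (Any.here refl)  = p∩q⊆p B (⋂ Bs)
  ⋂-⊆ {Bs = C ∷ Bs} (Any.there B∈Bs) = ⊆-trans (p∩q⊆q C (⋂ Bs)) (⋂-⊆ B∈Bs)

  ⋂-closed : ∀ {𝒟 : Pred (Subset n) 0ℓ} → 𝒟 ⊤ → (∀ A B → 𝒟 A → 𝒟 B → 𝒟 (A ∩ B)) →
             ∀ {Bs} → All 𝒟 Bs → 𝒟 (⋂ Bs)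
  ⋂-closed ⊤∈𝒟 ∩-closed []            = ⊤∈𝒟
  ⋂-closed ⊤∈𝒟 ∩-closed (B∈𝒟 ∷ Bs∈𝒟) = ∩-closed _ _ B∈𝒟 (⋂-closed ⊤∈𝒟 ∩-closed Bs∈𝒟)

module _ {n : ℕ} {𝒟 : Pred (Subset n) 0ℓ} (𝒟? : Decidable 𝒟) where

  private
    supersets : ∀ A → All (λ B → 𝒟 B × A ⊆ B) (filter (λ B → 𝒟? B ×-dec (A ⊆? B)) (allSubsets n))
    supersets A = all-filter (λ B → 𝒟? B ×-dec (A ⊆? B)) (allSubsets n)

  ⊆-sup : ∀ A → A ⊆ sup 𝒟? A
  ⊆-sup A = ⊆-⋂ (All.map proj₂ (supersets A))

  sup-least : ∀ {A B} → 𝒟 B → A ⊆ B → sup 𝒟? A ⊆ B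
  sup-least {A} {B} B∈𝒟 A⊆B = ⋂-⊆ (∈-filter⁺ (λ B → 𝒟? B ×-dec (A ⊆? B)) (∈-allSubsets B) (B∈𝒟 , A⊆B))

  sup∈𝒟 : 𝒟 ⊤ → (∀ A B → 𝒟 A → 𝒟 B → 𝒟 (A ∩ B)) → ∀ A → 𝒟 (sup 𝒟? A)
  sup∈𝒟 ⊤∈𝒟 ∩-closed A = ⋂-closed ⊤∈𝒟 ∩-closed (All.map proj₁ (supersets A))

module AtomAdjunction {n : ℕ} (𝒟 : Pred (Subset n) 0ℓ) (a : Fin n) where

  open import Algebra.Properties.CommutativeSemigroup
    (CommutativeMonoid.commutativeSemigroup (∪-commutativeMonoid n))
    using () renaming (interchange to ∪-interchange; xy∙z≈xz∙y to ∪-xy∙z≈xz∙y)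

  New : Subset n → Set
  New X = ¬ 𝒟 X × a ∈ X × 𝒟 (X - a)

  old-or-new : Decidable 𝒟 → ∀ {X} → (𝒟 [ a ]) X → 𝒟 X ⊎ New X
  old-or-new 𝒟? (inj₁ X∈𝒟) = inj₁ X∈𝒟
  old-or-new 𝒟? (inj₂ (S , S∈𝒟 , refl)) with 𝒟? (S ∪ ⁅ a ⁆)
  ... | yes S+a∈𝒟 = inj₁ S+a∈𝒟
  ... | no  S+a∉𝒟 =
    inj₂ (S+a∉𝒟 , q⊆p∪q S ⁅ a ⁆ (x∈⁅x⁆ a) , subst 𝒟 (sym (x∉p⇒p∪⁅x⁆-x≡p a∉S)) S∈𝒟)
    where
    a∉S : a ∉ S
    a∉S a∈S = S+a∉𝒟 (subst 𝒟 (sym (x∈p⇒p∪⁅x⁆≡p a∈S)) S∈𝒟)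

  [a]-accessible : Decidable 𝒟 →
    (∀ A → 𝒟 A → Nonempty A → Σ (Fin n) λ x → x ∈ A × 𝒟 (A - x)) →
    ∀ A → (𝒟 [ a ]) A → Nonempty A → Σ (Fin n) λ x → x ∈ A × (𝒟 [ a ]) (A - x)
  [a]-accessible 𝒟? accessible A A∈𝒟[a] A-nonempty with old-or-new 𝒟? A∈𝒟[a]
  ... | inj₂ (_ , a∈A , A-a∈𝒟) = a , a∈A , inj₁ A-a∈𝒟
  ... | inj₁ A∈𝒟 with accessible A A∈𝒟 A-nonempty
  ...   | x , x∈A , A-x∈𝒟 = x , x∈A , inj₁ A-x∈𝒟

  module _ (∪-closed : ∀ A B → 𝒟 A → 𝒟 B → 𝒟 (A ∪ B)) where

    [a]-∪-closed : ∀ A B → (𝒟 [ a ]) A → (𝒟 [ a ]) B → (𝒟 [ a ]) (A ∪ B)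
    [a]-∪-closed A B (inj₁ A∈𝒟) (inj₁ B∈𝒟) = inj₁ (∪-closed A B A∈𝒟 B∈𝒟)
    [a]-∪-closed _ B (inj₂ (S , S∈𝒟 , refl)) (inj₁ B∈𝒟) =
      inj₂ (S ∪ B , ∪-closed S B S∈𝒟 B∈𝒟 , ∪-xy∙z≈xz∙y S ⁅ a ⁆ B)
    [a]-∪-closed A _ (inj₁ A∈𝒟) (inj₂ (T , T∈𝒟 , refl)) =
      inj₂ (A ∪ T , ∪-closed A T A∈𝒟 T∈𝒟 , sym (∪-assoc A T ⁅ a ⁆))
    [a]-∪-closed _ _ (inj₂ (S , S∈𝒟 , refl)) (inj₂ (T , T∈𝒟 , refl)) =
      inj₂ (S ∪ T , ∪-closed S T S∈𝒟 T∈𝒟 ,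
            trans (∪-interchange S ⁅ a ⁆ T ⁅ a ⁆) (cong ((S ∪ T) ∪_) (∪-idem ⁅ a ⁆)))

  module _ (∩-closed : ∀ A B → 𝒟 A → 𝒟 B → 𝒟 (A ∩ B)) where

    private
      new∩old : ∀ {S B} → 𝒟 S → 𝒟 B → (𝒟 [ a ]) ((S ∪ ⁅ a ⁆) ∩ B)
      new∩old {S} {B} S∈𝒟 B∈𝒟 with a ∈? B
      ... | yes a∈B = inj₂ (S ∩ B , ∩-closed S B S∈𝒟 B∈𝒟 ,
                           trans (∩-distribʳ-∪ B S ⁅ a ⁆) (cong ((S ∩ B) ∪_) (x∈p⇒⁅x⁆∩p≡⁅x⁆ a∈B)))
      ... | no  a∉B = inj₁ (subst 𝒟 S∩B≡ (∩-closed S B S∈𝒟 B∈𝒟))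
        where
        S∩B≡ : S ∩ B ≡ (S ∪ ⁅ a ⁆) ∩ B
        S∩B≡ = sym (trans (∩-distribʳ-∪ B S ⁅ a ⁆)
                          (trans (cong ((S ∩ B) ∪_) (x∉p⇒⁅x⁆∩p≡⊥ a∉B)) (∪-identityʳ (S ∩ B))))

    [a]-∩-closed : ∀ A B → (𝒟 [ a ]) A → (𝒟 [ a ]) B → (𝒟 [ a ]) (A ∩ B)
    [a]-∩-closed A B (inj₁ A∈𝒟) (inj₁ B∈𝒟) = inj₁ (∩-closed A B A∈𝒟 B∈𝒟)
    [a]-∩-closed _ B (inj₂ (S , S∈𝒟 , refl)) (inj₁ B∈𝒟) = new∩old S∈𝒟 B∈𝒟
    [a]-∩-closed A _ (inj₁ A∈𝒟) (inj₂ (T , T∈𝒟 , refl)) =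
      subst (𝒟 [ a ]) (∩-comm (T ∪ ⁅ a ⁆) A) (new∩old T∈𝒟 A∈𝒟)
    [a]-∩-closed _ _ (inj₂ (S , S∈𝒟 , refl)) (inj₂ (T , T∈𝒟 , refl)) =
      inj₂ (S ∩ T , ∩-closed S T S∈𝒟 T∈𝒟 , sym (∪-distribʳ-∩ ⁅ a ⁆ S T))

module _ {n : ℕ} {𝒟 : Pred (Subset n) 0ℓ} {ρ : Subset n → ℕ} (U : IsUMatroid 𝒟 ρ) where

  open IsUMatroid U

  ρ-∪⁅⁆≤suc : ∀ {A e} → 𝒟 A → 𝒟 (A ∪ ⁅ e ⁆) → ρ (A ∪ ⁅ e ⁆) ≤ suc (ρ A)
  ρ-∪⁅⁆≤suc {A} {e} A∈𝒟 A+e∈𝒟 = begin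
    ρ (A ∪ ⁅ e ⁆)                ≤⟨ m≤n+m∸n _ (ρ A) ⟩
    ρ A + (ρ (A ∪ ⁅ e ⁆) ∸ ρ A)  ≤⟨ +-monoʳ-≤ (ρ A) (unitIncrease A e A∈𝒟 A+e∈𝒟) ⟩
    ρ A + 1                      ≡⟨ +-comm (ρ A) 1 ⟩
    suc (ρ A)                    ∎
    where open ≤-Reasoning

  private
    ρ≤ρ+∣─∣-step-∉ : ∀ {X Y x} → x ∈ X → x ∉ Y → 𝒟 X → 𝒟 (X - x) →
      ρ (X - x) ≤ ρ Y + ∣ X - x ─ Y ∣ → ρ X ≤ ρ Y + ∣ X ─ Y ∣
    ρ≤ρ+∣─∣-step-∉ {X} {Y} {x} x∈X x∉Y X∈𝒟 X-x∈𝒟 ih = begin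
      ρ X                ≡⟨ cong ρ (x∈p⇒p-x∪⁅x⁆≡p x∈X) ⟨
      ρ ((X - x) ∪ ⁅ x ⁆) ≤⟨ ρ-∪⁅⁆≤suc X-x∈𝒟 (subst 𝒟 (sym (x∈p⇒p-x∪⁅x⁆≡p x∈X)) X∈𝒟) ⟩
      suc (ρ (X - x))     ≤⟨ s≤s ih ⟩
      suc (ρ Y + ∣ X - x ─ Y ∣) ≤⟨ +-monoʳ-< (ρ Y) (∣p-x─q∣<∣p─q∣ x∈X x∉Y) ⟩
      ρ Y + ∣ X ─ Y ∣     ∎
      where open ≤-Reasoning

    -- X ⊆ (X - x) ∪ Y, and submodularity on X - x and Y reduces the bound to the
    -- one for X - x against (X - x) ∩ Y.
    ρ≤ρ+∣─∣-step-∈ : ∀ {X Y x} → x ∈ Y → 𝒟 X → 𝒟 (X - x) → 𝒟 Y →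
      ρ (X - x) ≤ ρ ((X - x) ∩ Y) + ∣ X - x ─ (X - x) ∩ Y ∣ → ρ X ≤ ρ Y + ∣ X ─ Y ∣
    ρ≤ρ+∣─∣-step-∈ {X} {Y} {x} x∈Y X∈𝒟 X-x∈𝒟 Y∈𝒟 ih = +-cancelʳ-≤ i _ _ (begin
      ρ X + i                 ≤⟨ +-monoˡ-≤ i (monotone _ _ X∈𝒟 X-x∪Y∈𝒟 (p⊆p-x∪q x∈Y)) ⟩
      ρ ((X - x) ∪ Y) + i     ≤⟨ submodular (X - x) Y X-x∈𝒟 Y∈𝒟 ⟩
      ρ (X - x) + ρ Y         ≤⟨ +-monoˡ-≤ (ρ Y) ih ⟩
      i + d + ρ Y             ≡⟨ +-comm (i + d) (ρ Y) ⟩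
      ρ Y + (i + d)           ≡⟨ cong (ρ Y +_) (+-comm i d) ⟩
      ρ Y + (d + i)           ≡⟨ +-assoc (ρ Y) d i ⟨
      ρ Y + d + i             ≤⟨ +-monoˡ-≤ i (+-monoʳ-≤ (ρ Y) (∣r─r∩q∣≤∣p─q∣ Y (p─q⊆p X ⁅ x ⁆))) ⟩
      ρ Y + ∣ X ─ Y ∣ + i     ∎)
      where
      open ≤-Reasoning
      i = ρ ((X - x) ∩ Y)
      d = ∣ X - x ─ (X - x) ∩ Y ∣
      X-x∪Y∈𝒟 = ∪-closed (X - x) Y X-x∈𝒟 Y∈𝒟

  ρ≤ρ+∣─∣ : ∀ {X Y} → 𝒟 X → 𝒟 Y → ρ X ≤ ρ Y + ∣ X ─ Y ∣
  ρ≤ρ+∣─∣ {X} = go X (<-wellFounded ∣ X ∣)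
    where
    go : ∀ X → Acc _<_ ∣ X ∣ → ∀ {Y} → 𝒟 X → 𝒟 Y → ρ X ≤ ρ Y + ∣ X ─ Y ∣
    go X (acc smaller) {Y} X∈𝒟 Y∈𝒟 with nonempty? X
    ... | no X-empty =
      ≤-trans (monotone X Y X∈𝒟 Y∈𝒟 (λ x∈X → contradiction (_ , x∈X) X-empty)) (m≤m+n _ _)
    ... | yes X-nonempty with accessible X X∈𝒟 X-nonempty
    ...   | x , x∈X , X-x∈𝒟 = remove (x ∈? Y)
      where
      ih : ∀ {Z} → 𝒟 Z → ρ (X - x) ≤ ρ Z + ∣ X - x ─ Z ∣
      ih = go (X - x) (smaller (x∈p⇒∣p-x∣<∣p∣ x∈X)) X-x∈𝒟

      remove : Dec (x ∈ Y) → ρ X ≤ ρ Y + ∣ X ─ Y ∣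
      remove (no  x∉Y) = ρ≤ρ+∣─∣-step-∉ x∈X x∉Y X∈𝒟 X-x∈𝒟 (ih Y∈𝒟)
      remove (yes x∈Y) = ρ≤ρ+∣─∣-step-∈ x∈Y X∈𝒟 X-x∈𝒟 Y∈𝒟 (ih (∩-closed _ _ X-x∈𝒟 Y∈𝒟))

module GenerousAtomExtension {n : ℕ} {𝒟 : Pred (Subset n) 0ℓ} (𝒟? : Decidable 𝒟) {ρ : Subset n → ℕ}
                             (U : IsUMatroid 𝒟 ρ) (a : Fin n) where

  open IsUMatroid U
  open AtomAdjunction 𝒟 a

  private
    ρa : Subset n → ℕ
    ρa = ρₐ 𝒟? ρ a

    σ : Subset n → Subset n
    σ = sup 𝒟?

    σ∈𝒟 : ∀ X → 𝒟 (σ X)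
    σ∈𝒟 = sup∈𝒟 𝒟? E∈𝒟 ∩-closed

  ρₐ-old : ∀ {X} → 𝒟 X → ρa X ≡ ρ X
  ρₐ-old {X} X∈𝒟 with 𝒟? X
  ... | yes _   = refl
  ... | no  X∉𝒟 = contradiction X∈𝒟 X∉𝒟

  ρₐ-new : ∀ {X} → New X → ρa X ≡ suc (ρ (X - a)) ⊓ ρ (σ X)
  ρₐ-new {X} (X∉𝒟 , _ , X-a∈𝒟) with 𝒟? X
  ... | yes X∈𝒟 = contradiction X∈𝒟 X∉𝒟
  ... | no  _ with ρ (X - a) ≟ ρ (sup 𝒟? X)
  ...   | yes eq  = trans eq (sym (m≥n⇒m⊓n≡n (≤-trans (≤-reflexive (sym eq)) (n≤1+n _))))
  ...   | no  neq = sym (m≤n⇒m⊓n≡m (≤∧≢⇒< ρ[X-a]≤ρ[σX] neq))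
    where
    ρ[X-a]≤ρ[σX] : ρ (X - a) ≤ ρ (σ X)
    ρ[X-a]≤ρ[σX] = monotone _ _ X-a∈𝒟 (σ∈𝒟 X) (⊆-trans (p─q⊆p X ⁅ a ⁆) (⊆-sup 𝒟? X))

  ρₐ≤ρ+∣─∣ : ∀ {X Y} → (𝒟 [ a ]) X → 𝒟 Y → ρa X ≤ ρ Y + ∣ X ─ Y ∣
  ρₐ≤ρ+∣─∣ {X} {Y} X∈𝒟[a] Y∈𝒟 with old-or-new 𝒟? X∈𝒟[a]
  ... | inj₁ X∈𝒟 = ≤-trans (≤-reflexive (ρₐ-old X∈𝒟)) (ρ≤ρ+∣─∣ U X∈𝒟 Y∈𝒟)
  ... | inj₂ new@(_ , a∈X , X-a∈𝒟) with a ∈? Y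
  ...   | yes a∈Y = begin
    ρa X                      ≤⟨ ≤-trans (≤-reflexive (ρₐ-new new)) (m⊓n≤n _ _) ⟩
    ρ (σ X)                   ≤⟨ monotone _ _ (σ∈𝒟 X) X-a∪Y∈𝒟 (sup-least 𝒟? X-a∪Y∈𝒟 (p⊆p-x∪q a∈Y)) ⟩
    ρ ((X - a) ∪ Y)           ≤⟨ ρ≤ρ+∣─∣ U X-a∪Y∈𝒟 Y∈𝒟 ⟩
    ρ Y + ∣ (X - a) ∪ Y ─ Y ∣ ≤⟨ +-monoʳ-≤ (ρ Y) (∣r∪q─q∣≤∣p─q∣ Y (p─q⊆p X ⁅ a ⁆)) ⟩
    ρ Y + ∣ X ─ Y ∣           ∎
    where
    open ≤-Reasoning
    X-a∪Y∈𝒟 = ∪-closed (X - a) Y X-a∈𝒟 Y∈𝒟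
  ...   | no  a∉Y = begin
    ρa X                      ≤⟨ ≤-trans (≤-reflexive (ρₐ-new new)) (m⊓n≤m _ _) ⟩
    suc (ρ (X - a))           ≤⟨ s≤s (ρ≤ρ+∣─∣ U X-a∈𝒟 Y∈𝒟) ⟩
    suc (ρ Y + ∣ X - a ─ Y ∣) ≤⟨ +-monoʳ-< (ρ Y) (∣p-x─q∣<∣p─q∣ a∈X a∉Y) ⟩
    ρ Y + ∣ X ─ Y ∣           ∎
    where open ≤-Reasoning

  private
    covered : ∀ {X Y} → X ⊆ Y → ρ Y + ∣ X ─ Y ∣ ≡ ρ Y
    covered {Y = Y} X⊆Y = trans (cong (ρ Y +_) (p⊆q⇒∣p─q∣≡0 X⊆Y)) (+-identityʳ (ρ Y))

  ρₐ-attained : ∀ {X} → (𝒟 [ a ]) X → Σ (Subset n) λ Y → 𝒟 Y × ρ Y + ∣ X ─ Y ∣ ≤ ρa X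
  ρₐ-attained {X} X∈𝒟[a] with old-or-new 𝒟? X∈𝒟[a]
  ... | inj₁ X∈𝒟 = X , X∈𝒟 , ≤-reflexive (trans (covered ⊆-refl) (sym (ρₐ-old X∈𝒟)))
  ... | inj₂ new@(_ , a∈X , X-a∈𝒟) with ⊓-sel (suc (ρ (X - a))) (ρ (σ X))
  ...   | inj₁ ρaX≡suc = X - a , X-a∈𝒟 , (begin
    ρ (X - a) + ∣ X ─ (X - a) ∣ ≤⟨ +-monoʳ-≤ (ρ (X - a)) (∣p─p-x∣≤1 X a) ⟩
    ρ (X - a) + 1               ≡⟨ +-comm (ρ (X - a)) 1 ⟩
    suc (ρ (X - a))             ≡⟨ trans (ρₐ-new new) ρaX≡suc ⟨
    ρa X                        ∎)
    where open ≤-Reasoning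
  ...   | inj₂ ρaX≡ρσX =
    σ X , σ∈𝒟 X , ≤-reflexive (trans (covered (⊆-sup 𝒟? X)) (sym (trans (ρₐ-new new) ρaX≡ρσX)))

  ρₐ-monotone : ∀ A B → (𝒟 [ a ]) A → (𝒟 [ a ]) B → A ⊆ B → ρa A ≤ ρa B
  ρₐ-monotone A B A∈𝒟[a] B∈𝒟[a] A⊆B with ρₐ-attained B∈𝒟[a]
  ... | Y , Y∈𝒟 , Y-optimal = begin
    ρa A            ≤⟨ ρₐ≤ρ+∣─∣ A∈𝒟[a] Y∈𝒟 ⟩
    ρ Y + ∣ A ─ Y ∣ ≤⟨ +-monoʳ-≤ (ρ Y) (∣p─r∣≤∣q─r∣ Y A⊆B) ⟩
    ρ Y + ∣ B ─ Y ∣ ≤⟨ Y-optimal ⟩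
    ρa B            ∎
    where open ≤-Reasoning

  ρₐ-submodular : ∀ A B → (𝒟 [ a ]) A → (𝒟 [ a ]) B → ρa (A ∪ B) + ρa (A ∩ B) ≤ ρa A + ρa B
  ρₐ-submodular A B A∈𝒟[a] B∈𝒟[a] with ρₐ-attained A∈𝒟[a] | ρₐ-attained B∈𝒟[a]
  ... | Y , Y∈𝒟 , Y-optimal | Z , Z∈𝒟 , Z-optimal = begin
    ρa (A ∪ B) + ρa (A ∩ B)
      ≤⟨ +-mono-≤ (ρₐ≤ρ+∣─∣ ([a]-∪-closed ∪-closed A B A∈𝒟[a] B∈𝒟[a]) (∪-closed Y Z Y∈𝒟 Z∈𝒟))
                  (ρₐ≤ρ+∣─∣ ([a]-∩-closed ∩-closed A B A∈𝒟[a] B∈𝒟[a]) (∩-closed Y Z Y∈𝒟 Z∈𝒟)) ⟩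
    (ρ (Y ∪ Z) + ∣ A ∪ B ─ Y ∪ Z ∣) + (ρ (Y ∩ Z) + ∣ A ∩ B ─ Y ∩ Z ∣)
      ≡⟨ interchange (ρ (Y ∪ Z)) _ (ρ (Y ∩ Z)) _ ⟩
    (ρ (Y ∪ Z) + ρ (Y ∩ Z)) + (∣ A ∪ B ─ Y ∪ Z ∣ + ∣ A ∩ B ─ Y ∩ Z ∣)
      ≤⟨ +-mono-≤ (submodular Y Z Y∈𝒟 Z∈𝒟) (∣p∪q─r∪s∣+∣p∩q─r∩s∣≤∣p─r∣+∣q─s∣ A B Y Z) ⟩
    (ρ Y + ρ Z) + (∣ A ─ Y ∣ + ∣ B ─ Z ∣)
      ≡⟨ interchange (ρ Y) (ρ Z) _ _ ⟩
    (ρ Y + ∣ A ─ Y ∣) + (ρ Z + ∣ B ─ Z ∣)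
      ≤⟨ +-mono-≤ Y-optimal Z-optimal ⟩
    ρa A + ρa B ∎
    where open ≤-Reasoning

  ρₐ-unitIncrease : ∀ A e → (𝒟 [ a ]) A → (𝒟 [ a ]) (A ∪ ⁅ e ⁆) → ρa (A ∪ ⁅ e ⁆) ∸ ρa A ≤ 1
  ρₐ-unitIncrease A e A∈𝒟[a] A+e∈𝒟[a] with ρₐ-attained A∈𝒟[a]
  ... | Y , Y∈𝒟 , Y-optimal = m≤n+o⇒m∸n≤o _ (ρa A) (begin
    ρa (A ∪ ⁅ e ⁆)                ≤⟨ ρₐ≤ρ+∣─∣ A+e∈𝒟[a] Y∈𝒟 ⟩
    ρ Y + ∣ A ∪ ⁅ e ⁆ ─ Y ∣       ≤⟨ +-monoʳ-≤ (ρ Y) (∣p∪q─r∣≤∣p─r∣+∣q∣ A ⁅ e ⁆ Y) ⟩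
    ρ Y + (∣ A ─ Y ∣ + ∣ ⁅ e ⁆ ∣) ≡⟨ +-assoc (ρ Y) _ _ ⟨
    ρ Y + ∣ A ─ Y ∣ + ∣ ⁅ e ⁆ ∣   ≤⟨ +-mono-≤ Y-optimal (≤-reflexive (∣⁅x⁆∣≡1 e)) ⟩
    ρa A + 1                      ∎)
    where open ≤-Reasoning

  isUMatroid : IsUMatroid (𝒟 [ a ]) ρa
  isUMatroid = record
    { ∅∈𝒟          = inj₁ ∅∈𝒟
    ; E∈𝒟          = inj₁ E∈𝒟
    ; ∪-closed     = [a]-∪-closed ∪-closed
    ; ∩-closed     = [a]-∩-closed ∩-closed
    ; accessible   = [a]-accessible 𝒟? accessible
    ; ρ-∅          = trans (ρₐ-old ∅∈𝒟) ρ-∅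
    ; monotone     = ρₐ-monotone
    ; submodular   = ρₐ-submodular
    ; unitIncrease = ρₐ-unitIncrease
    }

theorem4p10 : {n : ℕ} (𝒟 : Pred (Subset n) 0ℓ) (𝒟? : Decidable 𝒟) (ρ : Subset n → ℕ)
    → IsUMatroid 𝒟 ρ → (a : Fin n) → ¬ 𝒟 ⁅ a ⁆
    → IsUMatroid (𝒟 [ a ]) (ρₐ 𝒟? ρ a)
      × (∀ A → 𝒟 A → (𝒟 [ a ]) A)
      × (∀ A → 𝒟 A → ρₐ 𝒟? ρ a A ≡ ρ A)
theorem4p10 𝒟 𝒟? ρ U a _ = isUMatroid , (λ _ → inj₁) , (λ _ → ρₐ-old)
  where open GenerousAtomExtension 𝒟? U a
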